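{- Let $\mathbf{e}$ be a transitive relation on a set $E$ and let $(\mathbf{a}_i)_{i\in I}$ be a family of clopen subsets of $\mathbf{e}$. Then: (i) the set $\{\mathbf{a}_i: i\in I\}$ has a meet in $\mathrm{Clop}(\mathbf{e})$ if and only if $\mathrm{int}(\bigcap_{i\in I}\mathbf{a}_i)$ is clopen, and in that case this meet equals $\mathrm{int}(\bigcap_{i\in I}\mathbf{a}_i)$; (ii) the set $\{\mathbf{a}_i: i\in I\}$ has a join in $\mathrm{Clop}(\mathbf{e})$ if and only if $\mathrm{cl}(\bigcup_{i\in I}\mathbf{a}_i)$ is clopen, and in that case this join equals $\mathrm{cl}(\bigcup_{i\in I}\mathbf{a}_i)$.
   Context: A transitive relation $\mathbf{e}$ on $E$ is viewed as a set of ordered pairs. A subset $\mathbf{a}\subseteq\mathbf{e}$ is closed if transitive, open if $\mathbf{e}\setminus\mathbf{a}$ is transitive, clopen if both. $\mathrm{cl}$ is transitive closure, $\mathrm{int}(\mathbf{a})$ the largest open subset of $\mathbf{a}$. $\mathrm{Clop}(\mathbf{e})$ is the poset of clopen subsets of $\mathbf{e}$ under inclusion. -}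

module Defs where

open import Level using (Level; _⊔_; 0ℓ) renaming (suc to lsuc)
open import Data.Product using (Σ; _×_; _,_)
open import Relation.Nullary using (¬_)
open import Relation.Binary.Core using (Rel; _⇒_)
open import Relation.Binary.Definitions using (Transitive)

-- Subsets of a relation e on E are relations a with a ⊆ e (a ⇒ e).

_≐_ : ∀ {a ℓ₁ ℓ₂} {E : Set a} → Rel E ℓ₁ → Rel E ℓ₂ → Set (a ⊔ ℓ₁ ⊔ ℓ₂)
r ≐ s = (r ⇒ s) × (s ⇒ r)

Diff : ∀ {a ℓ₁ ℓ₂} {E : Set a} → Rel E ℓ₁ → Rel E ℓ₂ → Rel E (ℓ₁ ⊔ ℓ₂)
Diff e r x y = e x y × ¬ r x y

Closed : ∀ {a ℓ₁ ℓ₂} {E : Set a} → Rel E ℓ₁ → Rel E ℓ₂ → Set (a ⊔ ℓ₁ ⊔ ℓ₂)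
Closed e r = (r ⇒ e) × Transitive r

Open : ∀ {a ℓ₁ ℓ₂} {E : Set a} → Rel E ℓ₁ → Rel E ℓ₂ → Set (a ⊔ ℓ₁ ⊔ ℓ₂)
Open e r = (r ⇒ e) × Transitive (Diff e r)

Clopen : ∀ {a ℓ₁ ℓ₂} {E : Set a} → Rel E ℓ₁ → Rel E ℓ₂ → Set (a ⊔ ℓ₁ ⊔ ℓ₂)
Clopen e r = Closed e r × Open e r

data cl {a ℓ} {E : Set a} (r : Rel E ℓ) : Rel E (a ⊔ ℓ) where
  [_]  : ∀ {x y} → r x y → cl r x y
  step : ∀ {x y z} → cl r x y → cl r y z → cl r x z

int : ∀ {a ℓ} {E : Set a} → Rel E ℓ → Rel E ℓ → Rel E (a ⊔ lsuc ℓ)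
int {ℓ = ℓ} {E} e r x y = Σ (Rel E ℓ) λ b → Open e b × (b ⇒ r) × b x y

⋂ : ∀ {a i ℓ} {E : Set a} {I : Set i} → (I → Rel E ℓ) → Rel E (i ⊔ ℓ)
⋂ {I = I} r x y = ∀ (k : I) → r k x y

⋃ : ∀ {a i ℓ} {E : Set a} {I : Set i} → (I → Rel E ℓ) → Rel E (i ⊔ ℓ)
⋃ {I = I} r x y = Σ I λ k → r k x y

-- Clop(e): clopen subsets of e (relations E → E → Set), ordered by inclusion.
IsMeet : {E I : Set} → Rel E 0ℓ → (I → Rel E 0ℓ) → Rel E 0ℓ → Set₁
IsMeet e r m = Clopen e m × (∀ k → m ⇒ r k)
  × (∀ (c : Rel _ 0ℓ) → Clopen e c → (∀ k → c ⇒ r k) → c ⇒ m)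

IsJoin : {E I : Set} → Rel E 0ℓ → (I → Rel E 0ℓ) → Rel E 0ℓ → Set₁
IsJoin e r j = Clopen e j × (∀ k → r k ⇒ j)
  × (∀ (c : Rel _ 0ℓ) → Clopen e c → (∀ k → r k ⇒ c) → j ⇒ c)

HasMeet : {E I : Set} → Rel E 0ℓ → (I → Rel E 0ℓ) → Set₁
HasMeet {E} e r = Σ (Rel E 0ℓ) (IsMeet e r)

HasJoin : {E I : Set} → Rel E 0ℓ → (I → Rel E 0ℓ) → Set₁
HasJoin {E} e r = Σ (Rel E 0ℓ) (IsJoin e r)

module Submission where

-- The heart of the proof is one family of clopen "cuts".  For predicates
-- Q ⊆ P on E, the relation  Cut e P Q = {(x,y) ∈ e | P x, ¬ Q y}  is clopen.
-- Taking for Q the points strictly reachable from s along a relation w, and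
-- for P those points together with s itself, the cut contains no w-edge.
--  * Meets: if m is a meet and (s,t) lies in int(⋂ aᵢ), witnessed by an open
--    b ⊆ ⋂ aᵢ, cut along w = ⋃ (e ∖ aᵢ).  Openness of b keeps t unreachable,
--    so (s,t) lies in the cut; the cut lies below every aᵢ, hence below m.
--  * Joins: if j is a join, the complement of the cut along w = ⋃ aᵢ is
--    clopen and lies above every aᵢ, hence above j; so each pair (s,t) ∈ j
--    has t reachable from s, i.e. (s,t) ∈ cl(⋃ aᵢ).
-- Conversely int(⋂ aᵢ) and cl(⋃ aᵢ), when clopen, are the meet and join
-- (the interior being resized to the lowest universe by excluded middle).
-- Excluded middle enters in the meet cut, for complements, and for resizing.

open import Defs
open import Level using (Level; 0ℓ; _⊔_)
open import Data.Product using (_×_; Σ; _,_; proj₁; proj₂)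
open import Data.Sum using (_⊎_; inj₁; inj₂)
open import Data.Empty using (⊥-elim)
open import Function.Bundles using (_⇔_; mk⇔)
open import Relation.Nullary using (¬_; yes; no)
open import Relation.Nullary.Decidable using (True; toWitness; fromWitness)
open import Relation.Unary using (Pred)
open import Relation.Binary.Core using (Rel; _⇒_)
open import Relation.Binary.Definitions using (Transitive)
open import Relation.Binary.PropositionalEquality using (_≡_; refl)
open import Axiom.ExcludedMiddle using (ExcludedMiddle)
open import Axiom.DoubleNegationElimination using (em⇒dne)

private
  variable
    a ℓ ℓ₁ ℓ₂ p q : Level
    E : Set a

clopen-resp-≐ : (e : Rel E ℓ) {r : Rel E ℓ₁} {s : Rel E ℓ₂} →
  r ≐ s → Clopen e r → Clopen e s
clopen-resp-≐ e (r⇒s , s⇒r) ((r⊆e , r-trans) , (_ , e∖r-trans)) =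
  ((λ h → r⊆e (s⇒r h)) , (λ h k → r⇒s (r-trans (s⇒r h) (s⇒r k)))) ,
  ((λ h → r⊆e (s⇒r h)) , e∖s-trans)
  where
  e∖s-trans : Transitive (Diff e _)
  e∖s-trans (exy , ¬sxy) (eyz , ¬syz) =
    let (exz , ¬rxz) = e∖r-trans (exy , λ h → ¬sxy (r⇒s h))
                                 (eyz , λ h → ¬syz (r⇒s h))
    in exz , λ h → ¬rxz (s⇒r h)

cl-least : {w : Rel E ℓ₁} {c : Rel E ℓ₂} → Transitive c → w ⇒ c → cl w ⇒ c
cl-least c-trans w⇒c [ h ]      = w⇒c h
cl-least c-trans w⇒c (step h k) = c-trans (cl-least c-trans w⇒c h)
                                          (cl-least c-trans w⇒c k)

diff-antitone : {e : Rel E ℓ} {r : Rel E ℓ₁} {s : Rel E ℓ₂} →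
  r ⇒ s → Diff e s ⇒ Diff e r
diff-antitone r⇒s (exy , ¬sxy) = exy , λ h → ¬sxy (r⇒s h)

-- Classically the complement of a clopen sub-relation is clopen: its
-- closedness is the openness of r, and its complement within e is r again.
clopen-complement : ExcludedMiddle ℓ → (e r : Rel E ℓ) →
  Clopen e r → Clopen e (Diff e r)
clopen-complement em e r ((r⊆e , r-trans) , (_ , e∖r-trans)) =
  (proj₁ , e∖r-trans) , (proj₁ , e∖e∖r-trans)
  where
  e∖e∖r⇒r : Diff e (Diff e r) ⇒ r
  e∖e∖r⇒r (exy , ¬e∖r) = em⇒dne em λ ¬rxy → ¬e∖r (exy , ¬rxy)

  e∖e∖r-trans : Transitive (Diff e (Diff e r))
  e∖e∖r-trans h k = let rxz = r-trans (e∖e∖r⇒r h) (e∖e∖r⇒r k)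
                    in r⊆e rxz , λ (_ , ¬rxz) → ¬rxz rxz

int⊆ : {e r : Rel E ℓ} → int e r ⇒ r
int⊆ (b , _ , b⊆r , bxy) = b⊆r bxy

open⊆int : {e r b : Rel E ℓ} → Open e b → b ⇒ r → b ⇒ int e r
open⊆int {b = b} b-open b⊆r bxy = b , b-open , b⊆r , bxy

-- Excluded middle at a higher level makes every relation equal to one in
-- the lowest universe (needed because int lives one universe up).
resize : ExcludedMiddle ℓ → (r : Rel E ℓ) → Σ (Rel E 0ℓ) (r ≐_)
resize em r = (λ x y → True (em {r x y})) , fromWitness , toWitness

Cut : Rel E ℓ → Pred E p → Pred E q → Rel E (ℓ ⊔ p ⊔ q)
Cut e P Q x y = e x y × P x × ¬ Q y

-- If Q ⊆ P then the cut is clopen: a pair leaving it through an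
-- intermediate point y would need ¬ P y and ¬¬ Q y at once.
cut-clopen : {e : Rel E ℓ} {P : Pred E p} {Q : Pred E q} →
  Transitive e → (∀ {x} → Q x → P x) → Clopen e (Cut e P Q)
cut-clopen {e = e} {P} {Q} e-trans Q⊆P =
  (proj₁ , cut-trans) , (proj₁ , e∖cut-trans)
  where
  cut-trans : Transitive (Cut e P Q)
  cut-trans (exy , Px , _) (eyz , _ , ¬Qz) = e-trans exy eyz , Px , ¬Qz

  e∖cut-trans : Transitive (Diff e (Cut e P Q))
  e∖cut-trans (exy , ¬cutxy) (eyz , ¬cutyz) =
    e-trans exy eyz , λ (_ , Px , ¬Qz) →
      ¬cutxy (exy , Px , λ Qy → ¬cutyz (eyz , Q⊆P Qy , ¬Qz))

Reach : {E : Set a} → Rel E ℓ → E → Pred E (a ⊔ ℓ)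
Reach w s x = (x ≡ s) ⊎ cl w s x

ReachCut : {E : Set a} → Rel E ℓ₁ → Rel E ℓ₂ → E → Rel E (a ⊔ ℓ₁ ⊔ ℓ₂)
ReachCut e w s = Cut e (Reach w s) (cl w s)

reachCut-clopen : {e : Rel E ℓ₁} {w : Rel E ℓ₂} {s : E} →
  Transitive e → Clopen e (ReachCut e w s)
reachCut-clopen e-trans = cut-clopen e-trans inj₂

reachCut-avoids : {e : Rel E ℓ₁} {w : Rel E ℓ₂} {s x y : E} →
  w x y → ¬ ReachCut e w s x y
reachCut-avoids wxy (_ , inj₁ refl , ¬reach) = ¬reach [ wxy ]
reachCut-avoids wxy (_ , inj₂ sx  , ¬reach) = ¬reach (step sx [ wxy ])

module _ {E I : Set} {e : Rel E 0ℓ} {a : I → Rel E 0ℓ} where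

  meet≐int : ExcludedMiddle 0ℓ → Transitive e →
    ∀ {m} → IsMeet e a m → m ≐ int e (⋂ a)
  meet≐int em e-trans {m} ((_ , m-open) , m⊆a , greatest) =
    open⊆int {e = e} m-open (λ h k → m⊆a k h) , int⇒m
    where
    w : Rel E 0ℓ
    w = ⋃ λ k → Diff e (a k)

    cut⊆a : ∀ {s} k → ReachCut e w s ⇒ a k
    cut⊆a k {x} {y} cutxy with em {a k x y}
    ... | yes akxy = akxy
    ... | no ¬akxy = ⊥-elim (reachCut-avoids {e = e} (k , proj₁ cutxy , ¬akxy) cutxy)

    int⇒m : int e (⋂ a) ⇒ m
    int⇒m {s} {t} (b , (b⊆e , e∖b-trans) , b⊆⋂a , bst) =
      greatest (ReachCut e w s) (reachCut-clopen e-trans) cut⊆a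
        (b⊆e bst , inj₁ refl , λ reach → proj₂ (reach⇒e∖b reach) bst)
      where
      -- reaching t along w would leave b, since e ∖ b is transitive
      reach⇒e∖b : cl w ⇒ Diff e b
      reach⇒e∖b = cl-least e∖b-trans
        λ (k , e∖ak) → diff-antitone {e = e} {r = b} {s = a k} (λ bxy → b⊆⋂a bxy k) e∖ak

  join≐cl : ExcludedMiddle 0ℓ → Transitive e → (∀ k → a k ⇒ e) →
    ∀ {j} → IsJoin e a j → j ≐ cl (⋃ a)
  join≐cl em e-trans a⊆e {j} (((j⊆e , j-trans) , _) , a⊆j , least) =
    j⇒cl , cl-least j-trans (λ (k , h) → a⊆j k h)
    where
    w : Rel E 0ℓ
    w = ⋃ a

    j⇒cl : j ⇒ cl w
    j⇒cl {s} {t} jst = em⇒dne em λ ¬reach →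
      proj₂ (j⊆cocut jst) (j⊆e jst , inj₁ refl , ¬reach)
      where
      j⊆cocut : j ⇒ Diff e (ReachCut e w s)
      j⊆cocut = least _
        (clopen-complement em e _ (reachCut-clopen e-trans))
        (λ k h → a⊆e k h , reachCut-avoids {e = e} (k , h))

  int-clopen⇒meet : ExcludedMiddle (Level.suc 0ℓ) →
    Clopen e (int e (⋂ a)) → HasMeet e a
  int-clopen⇒meet em₁ int-clopen =
    m , clopen-resp-≐ e int≐m int-clopen ,
    (λ k h → int⊆ {e = e} (proj₂ int≐m h) k) ,
    (λ c (_ , c-open) c⊆a h → proj₁ int≐m (open⊆int c-open (λ g k → c⊆a k g) h))
    where
    m : Rel E 0ℓ
    m = proj₁ (resize em₁ (int e (⋂ a)))

    int≐m : int e (⋂ a) ≐ m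
    int≐m = proj₂ (resize em₁ (int e (⋂ a)))

  cl-clopen⇒join : Clopen e (cl (⋃ a)) → HasJoin e a
  cl-clopen⇒join cl-clopen =
    cl (⋃ a) , cl-clopen , (λ k h → [ k , h ]) ,
    (λ c ((_ , c-trans) , _) a⊆c → cl-least c-trans (λ (k , h) → a⊆c k h))

corollary5p7 : ExcludedMiddle 0ℓ → ExcludedMiddle (Level.suc 0ℓ) →
    (E : Set) (e : Rel E 0ℓ) → Transitive e →
    (I : Set) (a : I → Rel E 0ℓ) → (∀ i → Clopen e (a i)) →
    ((HasMeet e a ⇔ Clopen e (int e (⋂ a)))
    × (∀ m → IsMeet e a m → m ≐ int e (⋂ a)))
    × ((HasJoin e a ⇔ Clopen e (cl (⋃ a)))
    × (∀ j → IsJoin e a j → j ≐ cl (⋃ a)))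
corollary5p7 em₀ em₁ E e e-trans I a a-clopen =
  (mk⇔ meet⇒int-clopen (int-clopen⇒meet em₁) , λ _ → meet≐int em₀ e-trans) ,
  (mk⇔ join⇒cl-clopen cl-clopen⇒join , λ _ → join≐cl em₀ e-trans a⊆e)
  where
  a⊆e : ∀ k → a k ⇒ e
  a⊆e k = proj₁ (proj₁ (a-clopen k))

  meet⇒int-clopen : HasMeet e a → Clopen e (int e (⋂ a))
  meet⇒int-clopen (_ , is-meet) =
    clopen-resp-≐ e (meet≐int em₀ e-trans is-meet) (proj₁ is-meet)

  join⇒cl-clopen : HasJoin e a → Clopen e (cl (⋃ a))
  join⇒cl-clopen (_ , is-join) =
    clopen-resp-≐ e (join≐cl em₀ e-trans a⊆e is-join) (proj₁ is-join)
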